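{- Let $G=(\mathcal{V},\mathcal{E})$ be a finite undirected connected simple graph, let $a\in\mathcal{V}$, and let $e=\{a,x\}\in\mathcal{E}$ be an edge such that $a$ and $x$ lie in the same connected component of $G'=G\setminus e$ (the graph obtained by deleting the edge $e$). Then $\mathcal{H}_G(x,a)\leqslant\mathcal{H}_{G'}(x,a)$, where $\mathcal{H}_G$ and $\mathcal{H}_{G'}$ denote hitting times for the simple random walks on $G$ and $G'$ respectively.
   Context: The simple random walk moves from a vertex to each neighbor with probability $1/\deg$. $\mathcal{H}(x,a)$ is the expected number of steps for the walk started at $x$ to first reach $a$. -}

module Defs where

open import Data.Nat using (ℕ; zero; suc)
open import Data.Fin using (Fin; zero; suc; _≟_)
open import Data.Bool using (Bool; true; false; if_then_else_; _∧_; _∨_; not)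
open import Data.Integer using (+_)
open import Data.Rational using (ℚ; 0ℚ; 1ℚ; _+_; _*_; _/_)
open import Relation.Nullary.Decidable using (⌊_⌋)
open import Relation.Binary.PropositionalEquality using (_≡_)

record SimpleGraph (n : ℕ) : Set where
  field
    adj    : Fin n → Fin n → Bool
    sym    : ∀ u v → adj u v ≡ adj v u
    irrefl : ∀ v → adj v v ≡ false
open SimpleGraph public

sumFin : (n : ℕ) → (Fin n → ℚ) → ℚ
sumFin zero    f = 0ℚ
sumFin (suc n) f = f zero + sumFin n (λ i → f (suc i))

countFin : (n : ℕ) → (Fin n → Bool) → ℕ
countFin zero    f = zero
countFin (suc n) f = (if f zero then suc else (λ k → k)) (countFin n (λ i → f (suc i)))

degree : {n : ℕ} → SimpleGraph n → Fin n → ℕ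
degree {n} G v = countFin n (adj G v)

-- 1/d, with the harmless convention 1/0 = 0 (isolated vertices never move)
inv : ℕ → ℚ
inv zero    = 0ℚ
inv (suc k) = + 1 / suc k

data Reach {n : ℕ} (G : SimpleGraph n) : Fin n → Fin n → Set where
  here : ∀ {v} → Reach G v v
  step : ∀ {u w v} → adj G u w ≡ true → Reach G w v → Reach G u v

Connected : {n : ℕ} → SimpleGraph n → Set
Connected G = ∀ u v → Reach G u v

eqᵇ : {n : ℕ} → Fin n → Fin n → Bool
eqᵇ u v = ⌊ u ≟ v ⌋

deleteEdge : {n : ℕ} → SimpleGraph n → Fin n → Fin n → SimpleGraph n
deleteEdge {n} G a x = record
  { adj    = λ u v → adj G u v ∧ not ((eqᵇ u a ∧ eqᵇ v x) ∨ (eqᵇ u x ∧ eqᵇ v a))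
  ; sym    = symProof
  ; irrefl = irreflProof }
  where
  open import Relation.Binary.PropositionalEquality using (refl; cong₂; cong)
  open import Data.Bool.Properties using (∨-comm)
  symProof : ∀ u v → (adj G u v ∧ not ((eqᵇ u a ∧ eqᵇ v x) ∨ (eqᵇ u x ∧ eqᵇ v a)))
                   ≡ (adj G v u ∧ not ((eqᵇ v a ∧ eqᵇ u x) ∨ (eqᵇ v x ∧ eqᵇ u a)))
  symProof u v with eqᵇ u a | eqᵇ v x | eqᵇ u x | eqᵇ v a
  ... | p | q | r | s = cong₂ _∧_ (sym G u v) (cong not (lemma p q r s))
    where
    lemma : ∀ p q r s → ((p ∧ q) ∨ (r ∧ s)) ≡ ((s ∧ r) ∨ (q ∧ p))
    lemma false false false false = refl
    lemma false false false true  = refl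
    lemma false false true  false = refl
    lemma false false true  true  = refl
    lemma false true  false false = refl
    lemma false true  false true  = refl
    lemma false true  true  false = refl
    lemma false true  true  true  = refl
    lemma true  false false false = refl
    lemma true  false false true  = refl
    lemma true  false true  false = refl
    lemma true  false true  true  = refl
    lemma true  true  false false = refl
    lemma true  true  false true  = refl
    lemma true  true  true  false = refl
    lemma true  true  true  true  = refl
  irreflProof : ∀ v → (adj G v v ∧ not ((eqᵇ v a ∧ eqᵇ v x) ∨ (eqᵇ v x ∧ eqᵇ v a))) ≡ false
  irreflProof v rewrite irrefl G v = refl

-- Law of the simple random walk started at x and killed on its first
-- arrival at a:  killed G a x k v = P_x(X_k = v, X_j ≠ a for all j < k).
killed : {n : ℕ} → SimpleGraph n → Fin n → Fin n → ℕ → Fin n → ℚ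
killed {n} G a x zero    v = if eqᵇ v x then 1ℚ else 0ℚ
killed {n} G a x (suc k) w =
  sumFin n (λ v → if eqᵇ v a then 0ℚ
                  else (if adj G v w then killed G a x k v * inv (degree G v) else 0ℚ))

-- P_x(τ_a = k), where τ_a is the first hitting time of a
hitProb : {n : ℕ} → SimpleGraph n → Fin n → Fin n → ℕ → ℚ
hitProb G a x k = killed G a x k a

-- Partial sums of E_x[τ_a] = Σ_k k · P_x(τ_a = k):
-- partialHit G x a N = Σ_{k<N} k · P_x(τ_a = k).
-- The hitting time H_G(x,a) is the supremum (limit) of this nondecreasing sequence.
partialHit : {n : ℕ} → SimpleGraph n → Fin n → Fin n → ℕ → ℚ
partialHit G x a zero    = 0ℚ
partialHit G x a (suc N) = partialHit G x a N + (+ N / 1) * hitProb G a x N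

-- Let S k = P_x(τ_a > k) be the survival probabilities of the walk killed at a.  Summation by
-- parts turns the partial expectation Σ_{k ≤ N} k P_x(τ_a = k) into Σ_{k < N} (S k − S N).
-- Deleting {a, x} keeps every edge between vertices other than a and lowers degrees, so the
-- killed walk on G′ keeps at least as much mass off a at every time: S k ≤ S′ k.  In the first
-- step it even keeps the extra c = 1/deg x that the walk on G sends from x to a, S 1 + c = S′ 1.
-- As every vertex still reaches a in G′, S′ decays geometrically, so the truncation error
-- N S′ M of the partial sums for G′ drops below c, and the slack c pays for it.
module Submission where

open import Defs renaming (sym to adj-sym; irrefl to adj-irrefl)
open import Data.Bool using (Bool; true; false; if_then_else_)
open import Data.Bool.Properties using (∧-identityʳ)
open import Data.Empty using (⊥-elim)
open import Data.Fin using (Fin; zero; suc; _≟_)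
import Data.Integer as ℤ
import Data.Integer.Properties as ℤ
open import Data.Nat as ℕ using (ℕ; zero; suc; z≤n; s≤s)
import Data.Nat.Properties as ℕ
import Data.Nat.Coprimality as Coprime
open import Data.Product using (∃; ∃₂; _,_; _×_; proj₁; proj₂)
open import Data.Rational
  using (ℚ; 0ℚ; 1ℚ; _+_; _*_; _-_; -_; _/_; _≤_; _<_; mkℚ; *≤*; *<*; nonNegative; positive)
open import Data.Rational.Properties
  using ( ≤-refl; ≤-trans; ≤-reflexive; ≤-total; <⇒≤; module ≤-Reasoning; positive⁻¹
        ; normalize-coprime; +-assoc; +-identityˡ; +-identityʳ; +-inverseʳ; *-assoc; *-comm
        ; *-identityˡ; *-identityʳ; *-zeroˡ; *-zeroʳ; *-distribˡ-+; *-inverseʳ; neg-antimono-≤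
        ; +-mono-≤; +-monoˡ-≤; +-monoʳ-≤; *-monoˡ-≤-nonNeg; *-monoʳ-≤-nonNeg; *-monoˡ-<-pos )
open import Data.Rational.Solver using (module +-*-Solver)
open import Data.Sum using (inj₁; inj₂)
open import Relation.Nullary using (yes; no)
open import Relation.Binary.PropositionalEquality
  using (_≡_; _≢_; refl; sym; trans; cong; cong₂; subst; subst₂; module ≡-Reasoning)

open +-*-Solver

fromℕ : ℕ → ℚ
fromℕ k = ℤ.+ k / 1

fromℕ≡mkℚ : ∀ k → fromℕ k ≡ mkℚ (ℤ.+ k) 0 (Coprime.sym (Coprime.1-coprimeTo k))
fromℕ≡mkℚ k = normalize-coprime (Coprime.sym (Coprime.1-coprimeTo k))

fromℕ-+ : ∀ m n → fromℕ (m ℕ.+ n) ≡ fromℕ m + fromℕ n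
fromℕ-+ m n rewrite fromℕ≡mkℚ m | fromℕ≡mkℚ n =
  cong (_/ 1) (sym (trans (cong₂ ℤ._+_ (ℤ.*-identityʳ (ℤ.+ m)) (ℤ.*-identityʳ (ℤ.+ n))) (sym (ℤ.pos-+ m n))))

fromℕ-* : ∀ m n → fromℕ (m ℕ.* n) ≡ fromℕ m * fromℕ n
fromℕ-* m n rewrite fromℕ≡mkℚ m | fromℕ≡mkℚ n = cong (_/ 1) (ℤ.pos-* m n)

fromℕ-suc : ∀ k → fromℕ (suc k) ≡ 1ℚ + fromℕ k
fromℕ-suc = fromℕ-+ 1

fromℕ-nonNeg : ∀ k → 0ℚ ≤ fromℕ k
fromℕ-nonNeg k rewrite fromℕ≡mkℚ k = *≤* (subst (ℤ._≤_ (ℤ.+ 0)) (sym (ℤ.*-identityʳ (ℤ.+ k))) (ℤ.+≤+ z≤n))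

inv≡mkℚ : ∀ k → inv (suc k) ≡ mkℚ (ℤ.+ 1) k (Coprime.1-coprimeTo (suc k))
inv≡mkℚ k = normalize-coprime (Coprime.1-coprimeTo (suc k))

inv-nonNeg : ∀ d → 0ℚ ≤ inv d
inv-nonNeg zero    = ≤-refl
inv-nonNeg (suc k) rewrite inv≡mkℚ k = *≤* (ℤ.+≤+ z≤n)

inv-pos : ∀ {d} → 0 ℕ.< d → 0ℚ < inv d
inv-pos {suc k} _ rewrite inv≡mkℚ k = *<* (ℤ.+<+ (s≤s z≤n))

inv-antitone : ∀ {m n} → 0 ℕ.< m → m ℕ.≤ n → inv n ≤ inv m
inv-antitone {suc j} {suc k} _ j≤k rewrite inv≡mkℚ j | inv≡mkℚ k =
  *≤* (ℤ.*-monoˡ-≤-nonNeg (ℤ.+ 1) (ℤ.+≤+ j≤k))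

fromℕ*inv : ∀ {d} → 0 ℕ.< d → fromℕ d * inv d ≡ 1ℚ
fromℕ*inv {suc k} _ rewrite fromℕ≡mkℚ (suc k) | inv≡mkℚ k = *-inverseʳ (mkℚ (ℤ.+ suc k) 0 (Coprime.sym (Coprime.1-coprimeTo (suc k))))

*-monoˡ-≤ : ∀ {r p q} → 0ℚ ≤ r → p ≤ q → r * p ≤ r * q
*-monoˡ-≤ {r} 0≤r = *-monoˡ-≤-nonNeg r {{nonNegative 0≤r}}

*-monoʳ-≤ : ∀ {r p q} → 0ℚ ≤ r → p ≤ q → p * r ≤ q * r
*-monoʳ-≤ {r} 0≤r = *-monoʳ-≤-nonNeg r {{nonNegative 0≤r}}

*-nonNeg : ∀ {p q} → 0ℚ ≤ p → 0ℚ ≤ q → 0ℚ ≤ p * q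
*-nonNeg {p} {q} 0≤p 0≤q = subst (_≤ p * q) (*-zeroˡ q) (*-monoʳ-≤ 0≤q 0≤p)

*-pos : ∀ {p q} → 0ℚ < p → 0ℚ < q → 0ℚ < p * q
*-pos {p} {q} 0<p 0<q = subst (_< p * q) (*-zeroˡ q) (*-monoˡ-<-pos q {{positive 0<q}} 0<p)

archimedean : ∀ N {q} → 0ℚ < q → ∃ λ m → fromℕ N ≤ fromℕ m * q
archimedean N {mkℚ (ℤ.+ zero)    _ _} (*<* (ℤ.+<+ ()))
archimedean N {mkℚ ℤ.-[1+ _ ] _ _} (*<* ())
archimedean N {mkℚ (ℤ.+ suc p) d c} _ = N ℕ.* suc d , (begin
  fromℕ N                              ≡⟨ sym (*-identityʳ (fromℕ N)) ⟩
  fromℕ N * 1ℚ                         ≡⟨ cong (fromℕ N *_) (sym (fromℕ*inv {suc d} (s≤s z≤n))) ⟩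
  fromℕ N * (fromℕ (suc d) * inv (suc d)) ≡⟨ sym (*-assoc (fromℕ N) _ _) ⟩
  fromℕ N * fromℕ (suc d) * inv (suc d) ≡⟨ cong (_* inv (suc d)) (sym (fromℕ-* N (suc d))) ⟩
  fromℕ (N ℕ.* suc d) * inv (suc d)    ≤⟨ *-monoˡ-≤ (fromℕ-nonNeg (N ℕ.* suc d)) 1/[d+1]≤q ⟩
  fromℕ (N ℕ.* suc d) * mkℚ (ℤ.+ suc p) d c ∎)
  where
  open ≤-Reasoning
  1/[d+1]≤q : inv (suc d) ≤ mkℚ (ℤ.+ suc p) d c
  1/[d+1]≤q rewrite inv≡mkℚ d = *≤* (ℤ.*-monoʳ-≤-nonNeg (ℤ.+ suc d) {ℤ.+ 1} {ℤ.+ suc p} (ℤ.+≤+ (s≤s z≤n)))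

p≤p+q : ∀ {p q} → 0ℚ ≤ q → p ≤ p + q
p≤p+q {p} 0≤q = subst (_≤ p + _) (+-identityʳ p) (+-monoʳ-≤ p 0≤q)

p≤q⇒0≤q-p : ∀ {p q} → p ≤ q → 0ℚ ≤ q - p
p≤q⇒0≤q-p {p} {q} p≤q = subst (_≤ q - p) (+-inverseʳ p) (+-monoˡ-≤ (- p) p≤q)

p-q≤p : ∀ {p q} → 0ℚ ≤ q → p - q ≤ p
p-q≤p {p} 0≤q = ≤-trans (+-monoʳ-≤ p (neg-antimono-≤ 0≤q)) (≤-reflexive (+-identityʳ p))

p+r≤q⇒p≤q-r : ∀ {p q r} → p + r ≤ q → p ≤ q - r
p+r≤q⇒p≤q-r {p} {q} {r} p+r≤q = ≤-trans (≤-reflexive (sym (trans (+-assoc p r (- r))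
  (trans (cong (_+_ p) (+-inverseʳ r)) (+-identityʳ p))))) (+-monoˡ-≤ (- r) p+r≤q)

eqᵇ-refl : ∀ {n} (i : Fin n) → eqᵇ i i ≡ true
eqᵇ-refl i with i ≟ i
... | yes _   = refl
... | no i≢i = ⊥-elim (i≢i refl)

≢⇒eqᵇ≡false : ∀ {n} {i j : Fin n} → i ≢ j → eqᵇ i j ≡ false
≢⇒eqᵇ≡false {i = i} {j} i≢j with i ≟ j
... | yes i≡j = ⊥-elim (i≢j i≡j)
... | no _    = refl

eqᵇ≡false⇒≢ : ∀ {n} {i j : Fin n} → eqᵇ i j ≡ false → i ≢ j
eqᵇ≡false⇒≢ {i = i} e refl with trans (sym (eqᵇ-refl i)) e
... | ()

sumFin-cong : ∀ n {f g : Fin n → ℚ} → (∀ i → f i ≡ g i) → sumFin n f ≡ sumFin n g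
sumFin-cong zero    f≗g = refl
sumFin-cong (suc n) f≗g = cong₂ _+_ (f≗g zero) (sumFin-cong n (λ i → f≗g (suc i)))

sumFin-0 : ∀ n → sumFin n (λ _ → 0ℚ) ≡ 0ℚ
sumFin-0 zero    = refl
sumFin-0 (suc n) = trans (+-identityˡ _) (sumFin-0 n)

sumFin-+ : ∀ n (f g : Fin n → ℚ) → sumFin n (λ i → f i + g i) ≡ sumFin n f + sumFin n g
sumFin-+ zero    f g = sym (+-identityˡ 0ℚ)
sumFin-+ (suc n) f g = trans (cong (f zero + g zero +_) (sumFin-+ n _ _))
  (solve 4 (λ a b c d → (a :+ b) :+ (c :+ d) := (a :+ c) :+ (b :+ d)) refl
     (f zero) (g zero) (sumFin n (λ i → f (suc i))) (sumFin n (λ i → g (suc i))))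

sumFin-*ˡ : ∀ n c (f : Fin n → ℚ) → c * sumFin n f ≡ sumFin n (λ i → c * f i)
sumFin-*ˡ zero    c f = *-zeroʳ c
sumFin-*ˡ (suc n) c f = trans (*-distribˡ-+ c _ _) (cong (c * f zero +_) (sumFin-*ˡ n c _))

sumFin-*ʳ : ∀ n c (f : Fin n → ℚ) → sumFin n f * c ≡ sumFin n (λ i → f i * c)
sumFin-*ʳ n c f = trans (*-comm _ c) (trans (sumFin-*ˡ n c f) (sumFin-cong n (λ i → *-comm c (f i))))

sumFin-swap : ∀ n m (f : Fin n → Fin m → ℚ) →
  sumFin n (λ i → sumFin m (f i)) ≡ sumFin m (λ j → sumFin n (λ i → f i j))
sumFin-swap zero    m f = sym (sumFin-0 m)
sumFin-swap (suc n) m f = trans (cong (sumFin m (f zero) +_) (sumFin-swap n m (λ i → f (suc i))))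
  (sym (sumFin-+ m (f zero) _))

sumFin-mono-≤ : ∀ n {f g : Fin n → ℚ} → (∀ i → f i ≤ g i) → sumFin n f ≤ sumFin n g
sumFin-mono-≤ zero    f≤g = ≤-refl
sumFin-mono-≤ (suc n) f≤g = +-mono-≤ (f≤g zero) (sumFin-mono-≤ n (λ i → f≤g (suc i)))

sumFin-nonNeg : ∀ n {f : Fin n → ℚ} → (∀ i → 0ℚ ≤ f i) → 0ℚ ≤ sumFin n f
sumFin-nonNeg n {f} 0≤f = subst (_≤ sumFin n f) (sumFin-0 n) (sumFin-mono-≤ n 0≤f)

sumFin-single : ∀ n (f : Fin n → ℚ) j → (∀ i → i ≢ j → f i ≡ 0ℚ) → sumFin n f ≡ f j
sumFin-single (suc n) f zero    f≡0 = trans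
  (cong (f zero +_) (trans (sumFin-cong n (λ i → f≡0 (suc i) λ ())) (sumFin-0 n)))
  (+-identityʳ (f zero))
sumFin-single (suc n) f (suc j) f≡0 = trans
  (cong (_+ sumFin n (λ i → f (suc i))) (f≡0 zero λ ()))
  (trans (+-identityˡ _) (sumFin-single n (λ i → f (suc i)) j
    (λ i i≢j → f≡0 (suc i) (λ { refl → i≢j refl }))))

sumFin-count : ∀ n (b : Fin n → Bool) c →
  sumFin n (λ i → if b i then c else 0ℚ) ≡ fromℕ (countFin n b) * c
sumFin-count zero    b c = sym (*-zeroˡ c)
sumFin-count (suc n) b c with b zero
... | true  = trans (cong (c +_) (sumFin-count n (λ i → b (suc i)) c))
  (trans (solve 2 (λ c k → c :+ k :* c := (con 1ℚ :+ k) :* c) refl c (fromℕ (countFin n _)))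
         (cong (_* c) (sym (fromℕ-suc (countFin n _)))))
... | false = trans (+-identityˡ _) (sumFin-count n (λ i → b (suc i)) c)

sumFin-+-slack : ∀ n {f g : Fin n → ℚ} j {e} → (∀ i → f i ≤ g i) → f j + e ≤ g j →
  sumFin n f + e ≤ sumFin n g
sumFin-+-slack (suc n) {f} zero {e} f≤g fj+e≤gj = subst (_≤ _)
  (solve 3 (λ a b e → (a :+ e) :+ b := (a :+ b) :+ e) refl (f zero) (sumFin n (λ i → f (suc i))) e)
  (+-mono-≤ fj+e≤gj (sumFin-mono-≤ n (λ i → f≤g (suc i))))
sumFin-+-slack (suc n) {f} (suc j) {e} f≤g fj+e≤gj = subst (_≤ _) (sym (+-assoc (f zero) _ e))
  (+-mono-≤ (f≤g zero) (sumFin-+-slack n j (λ i → f≤g (suc i)) fj+e≤gj))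

countFin-mono : ∀ n {f g : Fin n → Bool} → (∀ i → f i ≡ true → g i ≡ true) →
  countFin n f ℕ.≤ countFin n g
countFin-mono zero    f⇒g = z≤n
countFin-mono (suc n) {f} {g} f⇒g with f zero in f₀ | g zero in g₀
... | true  | true  = s≤s (countFin-mono n (λ i → f⇒g (suc i)))
... | false | true  = ℕ.m≤n⇒m≤1+n (countFin-mono n (λ i → f⇒g (suc i)))
... | false | false = countFin-mono n (λ i → f⇒g (suc i))
... | true  | false with trans (sym (f⇒g zero f₀)) g₀
... | ()

countFin-pos : ∀ n (f : Fin n → Bool) i → f i ≡ true → 0 ℕ.< countFin n f
countFin-pos (suc n) f zero    fi rewrite fi = s≤s z≤n
countFin-pos (suc n) f (suc i) fi with f zero
... | true  = s≤s z≤n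
... | false = countFin-pos n (λ j → f (suc j)) i fi

sumℕ : ℕ → (ℕ → ℚ) → ℚ
sumℕ zero    f = 0ℚ
sumℕ (suc N) f = sumℕ N f + f N

sumℕ-mono-≤ : ∀ N {f g : ℕ → ℚ} → (∀ k → f k ≤ g k) → sumℕ N f ≤ sumℕ N g
sumℕ-mono-≤ zero    f≤g = ≤-refl
sumℕ-mono-≤ (suc N) f≤g = +-mono-≤ (sumℕ-mono-≤ N f≤g) (f≤g N)

sumℕ-≤-+ : ∀ {f : ℕ → ℚ} → (∀ k → 0ℚ ≤ f k) → ∀ j N → sumℕ N f ≤ sumℕ (j ℕ.+ N) f
sumℕ-≤-+ 0≤f zero    N = ≤-refl
sumℕ-≤-+ {f} 0≤f (suc j) N = ≤-trans (sumℕ-≤-+ 0≤f j N)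
  (subst (_≤ sumℕ (suc (j ℕ.+ N)) f) (+-identityʳ _) (+-monoʳ-≤ (sumℕ (j ℕ.+ N) f) (0≤f (j ℕ.+ N))))

sumℕ-+-slack : ∀ {f g : ℕ → ℚ} {j N c} → (∀ k → f k ≤ g k) → f j + c ≤ g j → j ℕ.< N →
  sumℕ N f + c ≤ sumℕ N g
sumℕ-+-slack {f} {g} {j} {suc N} {c} f≤g fj+c≤gj j<1+N with ℕ.m≤n⇒m<n∨m≡n (ℕ.≤-pred j<1+N)
... | inj₁ j<N = subst (_≤ sumℕ (suc N) g)
  (solve 3 (λ X s c → (X :+ c) :+ s := (X :+ s) :+ c) refl (sumℕ N f) (f N) c)
  (+-mono-≤ (sumℕ-+-slack f≤g fj+c≤gj j<N) (f≤g N))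
... | inj₂ refl = subst (_≤ sumℕ (suc N) g) (sym (+-assoc (sumℕ N f) (f N) c))
  (+-mono-≤ (sumℕ-mono-≤ N f≤g) fj+c≤gj)

sumℕ-by-parts : ∀ {S h : ℕ → ℚ} → (∀ k → S (suc k) + h (suc k) ≡ S k) →
  ∀ N → sumℕ (suc N) (λ k → fromℕ k * h k) ≡ sumℕ N S - fromℕ N * S N
sumℕ-by-parts {S} {h} S-step zero =
  solve 2 (λ h s → con 0ℚ :+ con 0ℚ :* h := con 0ℚ :- con 0ℚ :* s) refl (h 0) (S 0)
sumℕ-by-parts {S} {h} S-step (suc N) = begin
  sumℕ (suc N) (λ k → fromℕ k * h k) + fromℕ (suc N) * h (suc N)
    ≡⟨ cong₂ _+_ (sumℕ-by-parts S-step N) (cong (_* h (suc N)) (fromℕ-suc N)) ⟩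
  (sumℕ N S - fromℕ N * S N) + (1ℚ + fromℕ N) * h (suc N)
    ≡⟨ cong (λ t → (sumℕ N S - fromℕ N * t) + (1ℚ + fromℕ N) * h (suc N)) (sym (S-step N)) ⟩
  (sumℕ N S - fromℕ N * (S (suc N) + h (suc N))) + (1ℚ + fromℕ N) * h (suc N)
    ≡⟨ solve 4 (λ Σ s h m → (Σ :- m :* (s :+ h)) :+ (con 1ℚ :+ m) :* h
                           := (Σ :+ (s :+ h)) :- (con 1ℚ :+ m) :* s)
               refl (sumℕ N S) (S (suc N)) (h (suc N)) (fromℕ N) ⟩
  (sumℕ N S + (S (suc N) + h (suc N))) - (1ℚ + fromℕ N) * S (suc N)
    ≡⟨ cong₂ (λ t m → (sumℕ N S + t) - m * S (suc N)) (S-step N) (sym (fromℕ-suc N)) ⟩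
  sumℕ (suc N) S - fromℕ (suc N) * S (suc N) ∎
  where open ≡-Reasoning

antitone-≤ : ∀ {S : ℕ → ℚ} → (∀ k → S (suc k) ≤ S k) → ∀ {m n} → m ℕ.≤ n → S n ≤ S m
antitone-≤ {S} S↓ {m} m≤n = subst (λ k → S k ≤ S m) (ℕ.m∸n+n≡m m≤n) (drop _)
  where
  drop : ∀ j → S (j ℕ.+ m) ≤ S m
  drop zero    = ≤-refl
  drop (suc j) = ≤-trans (S↓ (j ℕ.+ m)) (drop j)

sumℕ-antitone-tail : ∀ {S : ℕ → ℚ} → (∀ k → S (suc k) ≤ S k) → ∀ j N →
  sumℕ N S - fromℕ N * S (j ℕ.+ N) ≤ sumℕ (j ℕ.+ N) S - fromℕ (j ℕ.+ N) * S (j ℕ.+ N)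
sumℕ-antitone-tail {S} S↓ j N = tail j ℕ.≤-refl
  where
  b : ℚ
  b = S (j ℕ.+ N)
  tail : ∀ i → i ℕ.≤ j → sumℕ N S - fromℕ N * b ≤ sumℕ (i ℕ.+ N) S - fromℕ (i ℕ.+ N) * b
  tail zero    _     = ≤-refl
  tail (suc i) i<j = ≤-trans (tail i (ℕ.<⇒≤ i<j)) (begin
    X - fromℕ (i ℕ.+ N) * b
      ≤⟨ p≤p+q (p≤q⇒0≤q-p (antitone-≤ S↓ (ℕ.+-monoˡ-≤ N (ℕ.<⇒≤ i<j)))) ⟩
    (X - fromℕ (i ℕ.+ N) * b) + (S (i ℕ.+ N) - b)
      ≡⟨ solve 4 (λ X s m b → (X :- m :* b) :+ (s :- b) := (X :+ s) :- (con 1ℚ :+ m) :* b)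
                 refl X (S (i ℕ.+ N)) (fromℕ (i ℕ.+ N)) b ⟩
    (X + S (i ℕ.+ N)) - (1ℚ + fromℕ (i ℕ.+ N)) * b
      ≡⟨ cong (λ m → (X + S (i ℕ.+ N)) - m * b) (sym (fromℕ-suc (i ℕ.+ N))) ⟩
    sumℕ (suc i ℕ.+ N) S - fromℕ (suc i ℕ.+ N) * b ∎)
    where
    open ≤-Reasoning
    X : ℚ
    X = sumℕ (i ℕ.+ N) S

contraction⇒vanishing : ∀ {S : ℕ → ℚ} {L δ} → (∀ k → 0ℚ ≤ S k) → (∀ k → S (suc k) ≤ S k) →
  0ℚ < δ → (∀ k → S (k ℕ.+ L) + δ * S k ≤ S k) →
  ∀ N {c} → 0ℚ < c → ∃ λ M → fromℕ N * S M ≤ c * S 0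
contraction⇒vanishing {S} {L} {δ} 0≤S S↓ 0<δ contract N {c} 0<c = m ℕ.* L , (begin
  fromℕ N * Sₘ                  ≤⟨ *-monoʳ-≤ (0≤S (m ℕ.* L)) N≤m[cδ] ⟩
  fromℕ m * (c * δ) * Sₘ        ≡⟨ solve 4 (λ m c d A → m :* (c :* d) :* A := c :* (m :* (d :* A)))
                                          refl (fromℕ m) c δ Sₘ ⟩
  c * (fromℕ m * (δ * Sₘ))      ≤⟨ *-monoˡ-≤ (<⇒≤ 0<c) (p≤p+q (0≤S (m ℕ.* L))) ⟩
  c * (fromℕ m * (δ * Sₘ) + Sₘ) ≤⟨ *-monoˡ-≤ (<⇒≤ 0<c) (bernoulli m) ⟩
  c * S 0                       ∎)
  where
  open ≤-Reasoning
  m : ℕ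
  m = proj₁ (archimedean N (*-pos 0<c 0<δ))
  N≤m[cδ] : fromℕ N ≤ fromℕ m * (c * δ)
  N≤m[cδ] = proj₂ (archimedean N (*-pos 0<c 0<δ))
  Sₘ : ℚ
  Sₘ = S (m ℕ.* L)
  bernoulli : ∀ m → fromℕ m * (δ * S (m ℕ.* L)) + S (m ℕ.* L) ≤ S 0
  bernoulli zero = ≤-reflexive (trans (cong (_+ S 0) (*-zeroˡ (δ * S 0))) (+-identityˡ (S 0)))
  bernoulli (suc m) = begin
    fromℕ (suc m) * (δ * A′) + A′  ≤⟨ +-monoˡ-≤ A′ (*-monoˡ-≤ (fromℕ-nonNeg (suc m)) (*-monoˡ-≤ (<⇒≤ 0<δ) A′≤A)) ⟩
    fromℕ (suc m) * (δ * A) + A′   ≡⟨ cong (λ t → t * (δ * A) + A′) (fromℕ-suc m) ⟩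
    (1ℚ + fromℕ m) * (δ * A) + A′  ≡⟨ solve 4 (λ A′ m d A → (con 1ℚ :+ m) :* (d :* A) :+ A′ := m :* (d :* A) :+ (A′ :+ d :* A))
                                              refl A′ (fromℕ m) δ A ⟩
    fromℕ m * (δ * A) + (A′ + δ * A) ≤⟨ +-monoʳ-≤ (fromℕ m * (δ * A)) contract-at-mL ⟩
    fromℕ m * (δ * A) + A          ≤⟨ bernoulli m ⟩
    S 0                            ∎
    where
    A A′ : ℚ
    A = S (m ℕ.* L)
    A′ = S (suc m ℕ.* L)
    A′≤A : A′ ≤ A
    A′≤A = antitone-≤ S↓ (ℕ.m≤n+m (m ℕ.* L) L)
    contract-at-mL : A′ + δ * A ≤ A
    contract-at-mL = subst (λ k → S k + δ * A ≤ A) (ℕ.+-comm (m ℕ.* L) L) (contract (m ℕ.* L))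

Fin-uniform : ∀ m (P : Fin m → ℕ → ℚ → Set) →
  (∀ u {ℓ ℓ′ δ δ′} → ℓ ℕ.≤ ℓ′ → δ′ ≤ δ → P u ℓ δ → P u ℓ′ δ′) →
  (∀ u → ∃₂ λ ℓ δ → 0ℚ < δ × P u ℓ δ) →
  ∃₂ λ L δ → 0ℚ < δ × ∀ u → P u L δ
Fin-uniform zero    P mono witness = 0 , 1ℚ , positive⁻¹ 1ℚ , λ ()
Fin-uniform (suc m) P mono witness
  with witness zero | Fin-uniform m (λ u → P (suc u)) (λ u → mono (suc u)) (λ u → witness (suc u))
... | ℓ , δ , 0<δ , P₀ | L , δ′ , 0<δ′ , Pₛ with ≤-total δ δ′
... | inj₁ δ≤δ′ = ℓ ℕ.+ L , δ , 0<δ , λ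
  { zero    → mono zero (ℕ.m≤m+n ℓ L) ≤-refl P₀
  ; (suc u) → mono (suc u) (ℕ.m≤n+m L ℓ) δ≤δ′ (Pₛ u) }
... | inj₂ δ′≤δ = ℓ ℕ.+ L , δ′ , 0<δ′ , λ
  { zero    → mono zero (ℕ.m≤m+n ℓ L) δ′≤δ P₀
  ; (suc u) → mono (suc u) (ℕ.m≤n+m L ℓ) ≤-refl (Pₛ u) }

notAt : ∀ {n} → Fin n → Fin n → ℚ
notAt a v = if eqᵇ v a then 0ℚ else 1ℚ

notAt-nonNeg : ∀ {n} (a v : Fin n) → 0ℚ ≤ notAt a v
notAt-nonNeg a v with eqᵇ v a
... | true  = ≤-refl
... | false = <⇒≤ (positive⁻¹ 1ℚ)

notAt≤1 : ∀ {n} (a v : Fin n) → notAt a v ≤ 1ℚ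
notAt≤1 a v with eqᵇ v a
... | true  = <⇒≤ (positive⁻¹ 1ℚ)
... | false = ≤-refl

module KilledWalk {n : ℕ} (H : SimpleGraph n) (a : Fin n) where

  forward : (Fin n → ℚ) → Fin n → ℚ
  forward μ w = sumFin n λ v →
    if eqᵇ v a then 0ℚ else (if adj H v w then μ v * inv (degree H v) else 0ℚ)

  backward : (Fin n → ℚ) → Fin n → ℚ
  backward g v =
    if eqᵇ v a then 0ℚ else sumFin n (λ w → if adj H v w then inv (degree H v) * g w else 0ℚ)

  backward^ : ℕ → (Fin n → ℚ) → Fin n → ℚ
  backward^ zero    g = g
  backward^ (suc L) g = backward (backward^ L g)

  ⟪_,_⟫ : (Fin n → ℚ) → (Fin n → ℚ) → ℚ
  ⟪ μ , g ⟫ = sumFin n (λ w → μ w * g w)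

  forward-backward : ∀ μ g → ⟪ forward μ , g ⟫ ≡ ⟪ μ , backward g ⟫
  forward-backward μ g = begin
    sumFin n (λ w → forward μ w * g w)                    ≡⟨ sumFin-cong n (λ w → sumFin-*ʳ n (g w) _) ⟩
    sumFin n (λ w → sumFin n (λ v → term v w * g w))      ≡⟨ sumFin-swap n n _ ⟩
    sumFin n (λ v → sumFin n (λ w → term v w * g w))      ≡⟨ sumFin-cong n row ⟩
    ⟪ μ , backward g ⟫                                     ∎
    where
    open ≡-Reasoning
    term : Fin n → Fin n → ℚ
    term v w = if eqᵇ v a then 0ℚ else (if adj H v w then μ v * inv (degree H v) else 0ℚ)
    row : ∀ v → sumFin n (λ w → term v w * g w) ≡ μ v * backward g v
    row v with eqᵇ v a
    ... | true  = trans (sumFin-cong n (λ w → *-zeroˡ (g w))) (trans (sumFin-0 n) (sym (*-zeroʳ (μ v))))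
    ... | false = trans (sumFin-cong n entry) (sym (sumFin-*ˡ n (μ v) _))
      where
      entry : ∀ w → (if adj H v w then μ v * inv (degree H v) else 0ℚ) * g w
                  ≡ μ v * (if adj H v w then inv (degree H v) * g w else 0ℚ)
      entry w with adj H v w
      ... | true  = *-assoc (μ v) _ (g w)
      ... | false = trans (*-zeroˡ (g w)) (sym (*-zeroʳ (μ v)))

  killed-+ : ∀ x L k g → ⟪ killed H a x (k ℕ.+ L) , g ⟫ ≡ ⟪ killed H a x k , backward^ L g ⟫
  killed-+ x zero    k g rewrite ℕ.+-identityʳ k = refl
  killed-+ x (suc L) k g rewrite ℕ.+-suc k L =
    trans (killed-+ x L (suc k) g) (forward-backward (killed H a x k) (backward^ L g))

  forward-nonNeg : ∀ {μ} → (∀ v → 0ℚ ≤ μ v) → ∀ w → 0ℚ ≤ forward μ w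
  forward-nonNeg {μ} 0≤μ w = sumFin-nonNeg n term
    where
    term : ∀ v → 0ℚ ≤ (if eqᵇ v a then 0ℚ else (if adj H v w then μ v * inv (degree H v) else 0ℚ))
    term v with eqᵇ v a | adj H v w
    ... | true  | _     = ≤-refl
    ... | false | true  = *-nonNeg (0≤μ v) (inv-nonNeg (degree H v))
    ... | false | false = ≤-refl

  killed-nonNeg : ∀ x k v → 0ℚ ≤ killed H a x k v
  killed-nonNeg x zero    v with eqᵇ v x
  ... | true  = <⇒≤ (positive⁻¹ 1ℚ)
  ... | false = ≤-refl
  killed-nonNeg x (suc k) v = forward-nonNeg (killed-nonNeg x k) v

  backward-mono-≤ : ∀ {g h} → (∀ w → g w ≤ h w) → ∀ v → backward g v ≤ backward h v
  backward-mono-≤ {g} {h} g≤h v with eqᵇ v a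
  ... | true  = ≤-refl
  ... | false = sumFin-mono-≤ n term
    where
    term : ∀ w → (if adj H v w then inv (degree H v) * g w else 0ℚ)
               ≤ (if adj H v w then inv (degree H v) * h w else 0ℚ)
    term w with adj H v w
    ... | true  = *-monoˡ-≤ (inv-nonNeg (degree H v)) (g≤h w)
    ... | false = ≤-refl

  backward-nonNeg : ∀ {g} → (∀ w → 0ℚ ≤ g w) → ∀ v → 0ℚ ≤ backward g v
  backward-nonNeg {g} 0≤g v with eqᵇ v a
  ... | true  = ≤-refl
  ... | false = sumFin-nonNeg n term
    where
    term : ∀ w → 0ℚ ≤ (if adj H v w then inv (degree H v) * g w else 0ℚ)
    term w with adj H v w
    ... | true  = *-nonNeg (inv-nonNeg (degree H v)) (0≤g w)
    ... | false = ≤-refl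

  -- survival x k = P_x(τ_a > k), and below survivalFrom L v = P_v(τ_a > L).
  survival : Fin n → ℕ → ℚ
  survival x k = ⟪ killed H a x k , notAt a ⟫

  survival-nonNeg : ∀ x k → 0ℚ ≤ survival x k
  survival-nonNeg x k = sumFin-nonNeg n (λ w → *-nonNeg (killed-nonNeg x k w) (notAt-nonNeg a w))

  survival-0≤1 : ∀ x → survival x 0 ≤ 1ℚ
  survival-0≤1 x = subst (_≤ 1ℚ) (sym (sumFin-single n _ x off-x)) at-x
    where
    off-x : ∀ w → w ≢ x → killed H a x 0 w * notAt a w ≡ 0ℚ
    off-x w w≢x rewrite ≢⇒eqᵇ≡false w≢x = *-zeroˡ (notAt a w)
    at-x : killed H a x 0 x * notAt a x ≤ 1ℚ
    at-x rewrite eqᵇ-refl x = subst (_≤ 1ℚ) (sym (*-identityˡ (notAt a x))) (notAt≤1 a x)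

  ⟪μ,notAt⟫+μa≡⟪μ,1⟫ : ∀ μ → ⟪ μ , notAt a ⟫ + μ a ≡ ⟪ μ , (λ _ → 1ℚ) ⟫
  ⟪μ,notAt⟫+μa≡⟪μ,1⟫ μ = begin
    ⟪ μ , notAt a ⟫ + μ a                                   ≡⟨ cong (⟪ μ , notAt a ⟫ +_) (sym (trans (sumFin-single n atA a offA) atA-a)) ⟩
    ⟪ μ , notAt a ⟫ + sumFin n atA                          ≡⟨ sym (sumFin-+ n _ atA) ⟩
    sumFin n (λ w → μ w * notAt a w + atA w)                ≡⟨ sumFin-cong n split ⟩
    ⟪ μ , (λ _ → 1ℚ) ⟫                                       ∎
    where
    open ≡-Reasoning
    atA : Fin n → ℚ
    atA w = if eqᵇ w a then μ w else 0ℚ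
    offA : ∀ w → w ≢ a → atA w ≡ 0ℚ
    offA w w≢a rewrite ≢⇒eqᵇ≡false w≢a = refl
    atA-a : atA a ≡ μ a
    atA-a rewrite eqᵇ-refl a = refl
    split : ∀ w → μ w * notAt a w + atA w ≡ μ w * 1ℚ
    split w with eqᵇ w a
    ... | true  = solve 1 (λ m → m :* con 0ℚ :+ m := m :* con 1ℚ) refl (μ w)
    ... | false = +-identityʳ _

  survivalFrom : ℕ → Fin n → ℚ
  survivalFrom L = backward^ L (notAt a)

  survival-+ : ∀ x k L → survival x (k ℕ.+ L) ≡ ⟪ killed H a x k , survivalFrom L ⟫
  survival-+ x k L = killed-+ x L k (notAt a)

  survivalFrom-nonNeg : ∀ L v → 0ℚ ≤ survivalFrom L v
  survivalFrom-nonNeg zero    = notAt-nonNeg a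
  survivalFrom-nonNeg (suc L) = backward-nonNeg (survivalFrom-nonNeg L)

  partialHit≡sumℕ : ∀ x N → partialHit H x a N ≡ sumℕ N (λ k → fromℕ k * hitProb H a x k)
  partialHit≡sumℕ x zero    = refl
  partialHit≡sumℕ x (suc N) = cong (_+ fromℕ N * hitProb H a x N) (partialHit≡sumℕ x N)

  partialHit-≤-+ : ∀ x j N → partialHit H x a N ≤ partialHit H x a (j ℕ.+ N)
  partialHit-≤-+ x j N = subst₂ _≤_ (sym (partialHit≡sumℕ x N)) (sym (partialHit≡sumℕ x (j ℕ.+ N)))
    (sumℕ-≤-+ (λ k → *-nonNeg (fromℕ-nonNeg k) (killed-nonNeg x k a)) j N)

  module PositiveDegrees (deg>0 : ∀ v → eqᵇ v a ≡ false → 0 ℕ.< degree H v) where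

    row-sum : ∀ v → eqᵇ v a ≡ false →
      sumFin n (λ w → if adj H v w then inv (degree H v) else 0ℚ) ≡ 1ℚ
    row-sum v v≠a = trans (sumFin-count n (adj H v) _) (fromℕ*inv (deg>0 v v≠a))

    backward-≤-notAt : ∀ {g} → (∀ w → g w ≤ 1ℚ) → ∀ v → backward g v ≤ notAt a v
    backward-≤-notAt {g} g≤1 v with eqᵇ v a in v≟a
    ... | true  = ≤-refl
    ... | false = ≤-trans (sumFin-mono-≤ n term) (≤-reflexive (row-sum v v≟a))
      where
      term : ∀ w → (if adj H v w then inv (degree H v) * g w else 0ℚ)
                 ≤ (if adj H v w then inv (degree H v) else 0ℚ)
      term w with adj H v w
      ... | true  = ≤-trans (*-monoˡ-≤ (inv-nonNeg (degree H v)) (g≤1 w)) (≤-reflexive (*-identityʳ _))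
      ... | false = ≤-refl

    backward-1 : ∀ v → backward (λ _ → 1ℚ) v ≡ notAt a v
    backward-1 v with eqᵇ v a in v≟a
    ... | true  = refl
    ... | false = trans (sumFin-cong n term) (row-sum v v≟a)
      where
      term : ∀ w → (if adj H v w then inv (degree H v) * 1ℚ else 0ℚ)
                 ≡ (if adj H v w then inv (degree H v) else 0ℚ)
      term w with adj H v w
      ... | true  = *-identityʳ _
      ... | false = refl

    survival-step : ∀ x k → survival x (suc k) + hitProb H a x (suc k) ≡ survival x k
    survival-step x k = begin
      survival x (suc k) + killed H a x (suc k) a  ≡⟨ ⟪μ,notAt⟫+μa≡⟪μ,1⟫ (killed H a x (suc k)) ⟩
      ⟪ killed H a x (suc k) , (λ _ → 1ℚ) ⟫       ≡⟨ forward-backward (killed H a x k) (λ _ → 1ℚ) ⟩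
      ⟪ killed H a x k , backward (λ _ → 1ℚ) ⟫    ≡⟨ sumFin-cong n (λ w → cong (killed H a x k w *_) (backward-1 w)) ⟩
      survival x k                                 ∎
      where open ≡-Reasoning

    survival-antitone : ∀ x k → survival x (suc k) ≤ survival x k
    survival-antitone x k = ≤-trans (p≤p+q (killed-nonNeg x (suc k) a)) (≤-reflexive (survival-step x k))

    partialHit-suc : ∀ x N → partialHit H x a (suc N) ≡ sumℕ N (survival x) - fromℕ N * survival x N
    partialHit-suc x N = trans (partialHit≡sumℕ x (suc N)) (sumℕ-by-parts (survival-step x) N)

    survivalFrom-≤-notAt : ∀ L v → survivalFrom L v ≤ notAt a v
    survivalFrom-≤-notAt zero    v = ≤-refl
    survivalFrom-≤-notAt (suc L) = backward-≤-notAt (λ w → ≤-trans (survivalFrom-≤-notAt L w) (notAt≤1 a w))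

    survivalFrom-antitone : ∀ v L → survivalFrom (suc L) v ≤ survivalFrom L v
    survivalFrom-antitone v zero    = backward-≤-notAt (notAt≤1 a) v
    survivalFrom-antitone v (suc L) = backward-mono-≤ (λ w → survivalFrom-antitone w L) v

  module Reaching (reach : ∀ u → Reach H u a) where

    deg>0 : ∀ v → eqᵇ v a ≡ false → 0 ℕ.< degree H v
    deg>0 v v≠a with reach v
    ... | here         = ⊥-elim (eqᵇ≡false⇒≢ v≠a refl)
    ... | step v~w _   = countFin-pos n (adj H v) _ v~w

    open PositiveDegrees deg>0 public

    Escapes : Fin n → ℕ → ℚ → Set
    Escapes u ℓ δ = survivalFrom ℓ u + δ ≤ 1ℚ

    Escapes-mono : ∀ u {ℓ ℓ′ δ δ′} → ℓ ℕ.≤ ℓ′ → δ′ ≤ δ → Escapes u ℓ δ → Escapes u ℓ′ δ′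
    Escapes-mono u {ℓ} {ℓ′} ℓ≤ℓ′ δ′≤δ esc = ≤-trans (+-mono-≤ later δ′≤δ) esc
      where
      later : survivalFrom ℓ′ u ≤ survivalFrom ℓ u
      later = antitone-≤ (survivalFrom-antitone u) ℓ≤ℓ′

    -- δ is the probability ∏ 1/deg uᵢ of following the given walk u = u₀ ~ u₁ ~ ⋯ ~ a.
    escape : ∀ {u} → Reach H u a → ∃₂ λ ℓ δ → 0ℚ < δ × Escapes u ℓ δ
    escape {u} r with eqᵇ u a in u≟a
    escape {u} r            | true = 0 , 1ℚ , positive⁻¹ 1ℚ ,
      ≤-reflexive (trans (cong (_+ 1ℚ) (cong (λ b → if b then 0ℚ else 1ℚ) u≟a)) (+-identityˡ 1ℚ))
    escape {u} here         | false = ⊥-elim (eqᵇ≡false⇒≢ u≟a refl)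
    escape {u} (step {w = w} u~w r) | false with escape r
    ... | ℓ , δ , 0<δ , esc = suc ℓ , i * δ , *-pos (inv-pos (deg>0 u u≟a)) 0<δ , (begin
      backward (survivalFrom ℓ) u + i * δ
        ≡⟨ cong (λ b → (if b then 0ℚ else step-sum) + i * δ) u≟a ⟩
      step-sum + i * δ
        ≤⟨ sumFin-+-slack n w term at-w ⟩
      sumFin n (λ w′ → if adj H u w′ then i else 0ℚ)
        ≡⟨ row-sum u u≟a ⟩
      1ℚ ∎)
      where
      open ≤-Reasoning
      i step-sum : ℚ
      i = inv (degree H u)
      step-sum = sumFin n (λ w′ → if adj H u w′ then i * survivalFrom ℓ w′ else 0ℚ)
      term : ∀ w′ → (if adj H u w′ then i * survivalFrom ℓ w′ else 0ℚ) ≤ (if adj H u w′ then i else 0ℚ)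
      term w′ with adj H u w′
      ... | true  = ≤-trans (*-monoˡ-≤ (inv-nonNeg (degree H u))
                      (≤-trans (survivalFrom-≤-notAt ℓ w′) (notAt≤1 a w′))) (≤-reflexive (*-identityʳ i))
      ... | false = ≤-refl
      at-w : (if adj H u w then i * survivalFrom ℓ w else 0ℚ) + i * δ ≤ (if adj H u w then i else 0ℚ)
      at-w rewrite u~w = ≤-trans (≤-reflexive (sym (*-distribˡ-+ i _ δ)))
        (≤-trans (*-monoˡ-≤ (inv-nonNeg (degree H u)) esc) (≤-reflexive (*-identityʳ i)))

    survival-contraction : ∀ {L δ} → (∀ u → Escapes u L δ) →
      ∀ x k → survival x (k ℕ.+ L) + δ * survival x k ≤ survival x k
    survival-contraction {L} {δ} esc x k = begin
      survival x (k ℕ.+ L) + δ * survival x k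
        ≡⟨ cong₂ _+_ (survival-+ x k L) (sumFin-*ˡ n δ _) ⟩
      ⟪ μ , survivalFrom L ⟫ + sumFin n (λ w → δ * (μ w * notAt a w))
        ≡⟨ sym (sumFin-+ n _ _) ⟩
      sumFin n (λ w → μ w * survivalFrom L w + δ * (μ w * notAt a w))
        ≤⟨ sumFin-mono-≤ n term ⟩
      survival x k ∎
      where
      open ≤-Reasoning
      μ : Fin n → ℚ
      μ = killed H a x k
      margin : ∀ w → survivalFrom L w + δ * notAt a w ≤ notAt a w
      margin w with eqᵇ w a in w≟a
      ... | true  = ≤-trans (≤-reflexive (trans (cong (survivalFrom L w +_) (*-zeroʳ δ)) (+-identityʳ _)))
                      (≤-trans (survivalFrom-≤-notAt L w) (≤-reflexive (cong (λ b → if b then 0ℚ else 1ℚ) w≟a)))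
      ... | false = ≤-trans (≤-reflexive (cong (survivalFrom L w +_) (*-identityʳ δ))) (esc w)
      term : ∀ w → μ w * survivalFrom L w + δ * (μ w * notAt a w) ≤ μ w * notAt a w
      term w = ≤-trans
        (≤-reflexive (solve 4 (λ m s d g → m :* s :+ d :* (m :* g) := m :* (s :+ d :* g))
                              refl (μ w) (survivalFrom L w) δ (notAt a w)))
        (*-monoˡ-≤ (killed-nonNeg x k w) (margin w))

    survival-vanishing : ∀ x N {c} → 0ℚ < c → ∃ λ M → fromℕ N * survival x M ≤ c
    survival-vanishing x N {c} 0<c =
      let L , δ , 0<δ , esc = Fin-uniform n Escapes Escapes-mono (λ u → escape (reach u))
          M , small = contraction⇒vanishing {survival x} {L} {δ} (survival-nonNeg x) (survival-antitone x) 0<δ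
                        (survival-contraction esc x) N 0<c
      in M , ≤-trans small (≤-trans (*-monoˡ-≤ (<⇒≤ 0<c) (survival-0≤1 x)) (≤-reflexive (*-identityʳ c)))

module TargetEdgeRemoval {n} {H H′ : SimpleGraph n} {a : Fin n}
  (H′⊆H : ∀ v w → adj H′ v w ≡ true → adj H v w ≡ true)
  (agree : ∀ v w → eqᵇ v a ≡ false → eqᵇ w a ≡ false → adj H′ v w ≡ adj H v w)
  (deg′>0 : ∀ v → eqᵇ v a ≡ false → 0 ℕ.< degree H′ v) where

  killed-≤ : ∀ x k w → eqᵇ w a ≡ false → killed H a x k w ≤ killed H′ a x k w
  killed-≤ x zero    w _   = ≤-refl
  killed-≤ x (suc k) w w≠a = sumFin-mono-≤ n term
    where
    term : ∀ v → (if eqᵇ v a then 0ℚ else (if adj H v w then killed H a x k v * inv (degree H v) else 0ℚ))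
               ≤ (if eqᵇ v a then 0ℚ else (if adj H′ v w then killed H′ a x k v * inv (degree H′ v) else 0ℚ))
    term v with eqᵇ v a in v≟a
    ... | true  = ≤-refl
    ... | false rewrite agree v w v≟a w≠a with adj H v w
    ... | false = ≤-refl
    ... | true  = ≤-trans (*-monoʳ-≤ (inv-nonNeg (degree H v)) (killed-≤ x k v v≟a))
                          (*-monoˡ-≤ (KilledWalk.killed-nonNeg H′ a x k v)
                            (inv-antitone (deg′>0 v v≟a) (countFin-mono n (H′⊆H v))))

  survival-≤ : ∀ x k → KilledWalk.survival H a x k ≤ KilledWalk.survival H′ a x k
  survival-≤ x k = sumFin-mono-≤ n term
    where
    term : ∀ w → killed H a x k w * notAt a w ≤ killed H′ a x k w * notAt a w
    term w with eqᵇ w a in w≟a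
    ... | true  = ≤-reflexive (trans (*-zeroʳ (killed H a x k w)) (sym (*-zeroʳ (killed H′ a x k w))))
    ... | false = *-monoʳ-≤ (<⇒≤ (positive⁻¹ 1ℚ)) (killed-≤ x k w w≟a)

hitProb-1 : ∀ {n} (H : SimpleGraph n) {a x} → x ≢ a →
  hitProb H a x 1 ≡ (if adj H x a then inv (degree H x) else 0ℚ)
hitProb-1 {n} H {a} {x} x≢a = trans (sumFin-single n _ x off-x) at-x
  where
  off-x : ∀ v → v ≢ x →
    (if eqᵇ v a then 0ℚ else (if adj H v a then (if eqᵇ v x then 1ℚ else 0ℚ) * inv (degree H v) else 0ℚ)) ≡ 0ℚ
  off-x v v≢x rewrite ≢⇒eqᵇ≡false v≢x with eqᵇ v a | adj H v a
  ... | true  | _     = refl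
  ... | false | true  = *-zeroˡ (inv (degree H v))
  ... | false | false = refl
  at-x : (if eqᵇ x a then 0ℚ else (if adj H x a then (if eqᵇ x x then 1ℚ else 0ℚ) * inv (degree H x) else 0ℚ))
       ≡ (if adj H x a then inv (degree H x) else 0ℚ)
  at-x rewrite ≢⇒eqᵇ≡false x≢a | eqᵇ-refl x with adj H x a
  ... | true  = *-identityˡ (inv (degree H x))
  ... | false = refl

module EdgeDeletion {n} (G : SimpleGraph n) (a x : Fin n) where

  G′ : SimpleGraph n
  G′ = deleteEdge G a x

  deleteEdge-⊆ : ∀ v w → adj G′ v w ≡ true → adj G v w ≡ true
  deleteEdge-⊆ v w v~w with adj G v w
  ... | true  = refl
  ... | false = v~w

  deleteEdge-agree : ∀ v w → eqᵇ v a ≡ false → eqᵇ w a ≡ false → adj G′ v w ≡ adj G v w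
  deleteEdge-agree v w v≠a w≠a rewrite v≠a | w≠a with eqᵇ v x
  ... | true  = ∧-identityʳ (adj G v w)
  ... | false = ∧-identityʳ (adj G v w)

  -- A walk in G can use the deleted edge only from x (or from a), where x⇝a takes over.
  reach-deleteEdge : Reach G′ x a → ∀ {u} → Reach G u a → Reach G′ u a
  reach-deleteEdge x⇝a here = here
  reach-deleteEdge x⇝a {u} (step {w = w} u~w r) with u ≟ a | u ≟ x
  ... | yes refl | _        = here
  ... | no _     | yes refl = x⇝a
  ... | no u≢a   | no u≢x   = step kept (reach-deleteEdge x⇝a r)
    where
    kept : adj G′ u w ≡ true
    kept rewrite ≢⇒eqᵇ≡false u≢a | ≢⇒eqᵇ≡false u≢x = trans (∧-identityʳ (adj G u w)) u~w

  adj-deleteEdge-x-a : x ≢ a → adj G′ x a ≡ false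
  adj-deleteEdge-x-a x≢a rewrite ≢⇒eqᵇ≡false x≢a | eqᵇ-refl x | eqᵇ-refl a with adj G x a
  ... | true  = refl
  ... | false = refl

  module Comparison (conn : Connected G) (a~x : adj G a x ≡ true) (x⇝a : Reach G′ x a) where

    module W  = KilledWalk G a
    module W′ = KilledWalk G′ a
    module R  = W.Reaching (λ u → conn u a)
    module R′ = W′.Reaching (λ u → reach-deleteEdge x⇝a (conn u a))
    open TargetEdgeRemoval {H = G} {H′ = G′} {a = a} deleteEdge-⊆ deleteEdge-agree R′.deg>0 public

    x≢a : x ≢ a
    x≢a refl with trans (sym a~x) (adj-irrefl G x)
    ... | ()

    c : ℚ
    c = inv (degree G x)

    0<c : 0ℚ < c
    0<c = inv-pos (R.deg>0 x (≢⇒eqᵇ≡false x≢a))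

    first-step-slack : W.survival x 1 + c ≡ W′.survival x 1
    first-step-slack = begin
      W.survival x 1 + c                     ≡⟨ cong (W.survival x 1 +_) hit-G ⟩
      W.survival x 1 + hitProb G a x 1       ≡⟨ R.survival-step x 0 ⟩
      W′.survival x 0                        ≡⟨ sym (R′.survival-step x 0) ⟩
      W′.survival x 1 + hitProb G′ a x 1     ≡⟨ cong (W′.survival x 1 +_) hit-G′ ⟩
      W′.survival x 1 + 0ℚ                   ≡⟨ +-identityʳ _ ⟩
      W′.survival x 1                        ∎
      where
      open ≡-Reasoning
      hit-G : c ≡ hitProb G a x 1
      hit-G rewrite hitProb-1 G x≢a | adj-sym G x a | a~x = refl
      hit-G′ : hitProb G′ a x 1 ≡ 0ℚ
      hit-G′ rewrite hitProb-1 G′ x≢a | adj-deleteEdge-x-a x≢a = refl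

lemma2 : {n : ℕ} (G : SimpleGraph n) → Connected G → (a x : Fin n) →
    adj G a x ≡ true → Reach (deleteEdge G a x) x a →
    (N : ℕ) → ∃ λ M → partialHit G x a N ≤ partialHit (deleteEdge G a x) x a M
lemma2 G conn a x a~x x⇝a N = suc (M ℕ.+ N′) , (begin
  partialHit G x a N                                    ≤⟨ W.partialHit-≤-+ x 3 N ⟩
  partialHit G x a (suc N′)                             ≡⟨ R.partialHit-suc x N′ ⟩
  sumℕ N′ S - fromℕ N′ * S N′                           ≤⟨ p-q≤p (*-nonNeg (fromℕ-nonNeg N′) (W.survival-nonNeg x N′)) ⟩
  sumℕ N′ S                                             ≤⟨ p+r≤q⇒p≤q-r (sumℕ-+-slack {N = N′} (survival-≤ x) (≤-reflexive first-step-slack) (s≤s (s≤s z≤n))) ⟩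
  sumℕ N′ S′ - c                                        ≤⟨ +-monoʳ-≤ (sumℕ N′ S′) (neg-antimono-≤ tail-small) ⟩
  sumℕ N′ S′ - fromℕ N′ * S′ (M ℕ.+ N′)                 ≤⟨ sumℕ-antitone-tail (R′.survival-antitone x) M N′ ⟩
  sumℕ (M ℕ.+ N′) S′ - fromℕ (M ℕ.+ N′) * S′ (M ℕ.+ N′) ≡⟨ sym (R′.partialHit-suc x (M ℕ.+ N′)) ⟩
  partialHit (deleteEdge G a x) x a (suc (M ℕ.+ N′))    ∎)
  where
  open ≤-Reasoning
  open EdgeDeletion.Comparison G a x conn a~x x⇝a
  N′ : ℕ
  N′ = suc (suc N)
  S S′ : ℕ → ℚ
  S  = W.survival x
  S′ = W′.survival x
  vanishing : ∃ λ M → fromℕ N′ * S′ M ≤ c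
  vanishing = R′.survival-vanishing x N′ 0<c
  M : ℕ
  M = proj₁ vanishing
  tail-small : fromℕ N′ * S′ (M ℕ.+ N′) ≤ c
  tail-small = ≤-trans (*-monoˡ-≤ (fromℕ-nonNeg N′) (antitone-≤ (R′.survival-antitone x) (ℕ.m≤m+n M N′)))
                       (proj₂ vanishing)
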